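{- Let $g(x)=\sum_{n\ge 1}\frac{2\,(4n+1)!}{(n+1)!\,(3n+2)!}\,x^n$ be a formal power series. Then $g$ satisfies the algebraic equation $$x\left(x^2+11x-1\right)+\left(4x^3+25x^2-14x+1\right)g(x)+x\left(6x^2+17x+3\right)g(x)^2+x^2(4x+3)\,g(x)^3+x^3\,g(x)^4=0.$$ -}

module Defs where

open import Data.Nat as ℕ using (ℕ; zero; suc; _!)
open import Data.Nat.Properties using (_!*_!≢0)
open import Data.Integer as ℤ using (ℤ)
open import Data.Rational using (ℚ; _/_; _+_; _*_; -_; 0ℚ; 1ℚ)

-- Formal power series over ℚ, represented by their coefficient sequence:
-- a series f stands for Σ_{n ≥ 0} f n · xⁿ.
PowerSeries : Set
PowerSeries = ℕ → ℚ

sumBelow : (ℕ → ℚ) → ℕ → ℚ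
sumBelow f zero    = 0ℚ
sumBelow f (suc n) = sumBelow f n + f n

infixl 6 _⊕_
infixl 7 _⊛_
infixr 8 _^ˢ_

_⊕_ : PowerSeries → PowerSeries → PowerSeries
(f ⊕ g) n = f n + g n

_⊛_ : PowerSeries → PowerSeries → PowerSeries
(f ⊛ g) n = sumBelow (λ k → f k * g (n ℕ.∸ k)) (suc n)

const : ℚ → PowerSeries
const c zero    = c
const c (suc n) = 0ℚ

X : PowerSeries
X (suc zero) = 1ℚ
X _          = 0ℚ

κ : ℤ → PowerSeries
κ z = const (z / 1)

_^ˢ_ : PowerSeries → ℕ → PowerSeries
f ^ˢ zero  = const 1ℚ
f ^ˢ suc k = f ⊛ (f ^ˢ k)

g : PowerSeries
g zero    = 0ℚ
g (suc m) = ℤ.+ (2 ℕ.* (4 ℕ.* n ℕ.+ 1) !) / ((n ℕ.+ 1) ! ℕ.* (3 ℕ.* n ℕ.+ 2) !)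
  where
    n = suc m
    instance _ = (n ℕ.+ 1) !*(3 ℕ.* n ℕ.+ 2) !≢0

lhs : PowerSeries → PowerSeries
lhs h =
    X ⊛ (X ^ˢ 2 ⊕ κ (ℤ.+ 11) ⊛ X ⊕ κ (ℤ.- ℤ.+ 1))
  ⊕ (κ (ℤ.+ 4) ⊛ X ^ˢ 3 ⊕ κ (ℤ.+ 25) ⊛ X ^ˢ 2 ⊕ κ (ℤ.- ℤ.+ 14) ⊛ X ⊕ κ (ℤ.+ 1)) ⊛ h
  ⊕ X ⊛ (κ (ℤ.+ 6) ⊛ X ^ˢ 2 ⊕ κ (ℤ.+ 17) ⊛ X ⊕ κ (ℤ.+ 3)) ⊛ h ^ˢ 2
  ⊕ X ^ˢ 2 ⊛ (κ (ℤ.+ 4) ⊛ X ⊕ κ (ℤ.+ 3)) ⊛ h ^ˢ 3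
  ⊕ X ^ˢ 3 ⊛ h ^ˢ 4

{-# OPTIONS --safe #-}
-- Let u be the power series with u = x (1 + u)⁴ and put h = u − u² − u³. Eliminating x with
-- u = x (1 + u)⁴ turns lhs h = 0 into a polynomial identity in u. Applying θ = x d/dx to the
-- defining equation expresses θu, and then θh, …, θ⁴h, as rational functions of u, from which
-- h satisfies the hypergeometric equation
--   3θ(θ + 1)(3θ + 1)(3θ + 2) h = x (4θ + 2)(4θ + 3)(4θ + 4)(4θ + 5) h + 120 x.
-- Comparing coefficients gives a first-order recurrence which the closed form g satisfies as
-- well; hence h = g.
module Submission where

open import Defs
open import Level using (0ℓ)
open import Function using (_∘_; id; _$_)
open import Data.Empty using (⊥; ⊥-elim)
open import Data.Unit using (⊤)
open import Data.Bool using (T)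
open import Data.Maybe using (Maybe; just; nothing)
open import Data.Product using (_,_; _×_)
open import Data.List using (List; []; _∷_)
open import Data.Fin using (_↑ˡ_; _↑ʳ_)
open import Data.Fin.Patterns using (0F; 1F; 2F; 3F; 4F; 5F)
open import Data.Vec using (Vec; []; _∷_; lookup; _++_; map)
import Data.Vec.Properties as Vec
open import Data.Nat as ℕ using (ℕ; zero; suc; _∸_; _<_; _≤_; s≤s; _!)
import Data.Nat.Properties as ℕ
open import Data.Nat.Induction using (<-rec)
import Data.Nat.Tactic.RingSolver as ℕ-Solver
open import Data.Integer as ℤ using ()
import Data.Integer.Properties as ℤ
open import Data.Rational using (ℚ; 0ℚ; 1ℚ; _+_; _*_; -_; _/_; 1/_; toℚᵘ)
import Data.Rational.Base as ℚ using (+-*-rawRing; ≢-nonZero)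
open import Data.Rational.Literals using (fromℤ)
import Data.Rational.Properties as ℚ
open import Data.Rational.Unnormalised as ℚᵘ using (mkℚᵘ; *≡*) renaming (_≃_ to _≃ᵘ_)
import Data.Rational.Unnormalised.Properties as ℚᵘ
open import Relation.Nullary using (does; yes; no)
open import Relation.Binary.PropositionalEquality
  using (_≡_; _≢_; _≗_; refl; sym; trans; cong; cong₂; module ≡-Reasoning)
open import Algebra.Bundles using (CommutativeRing)
open import Algebra.Structures using (IsCommutativeRing)
import Algebra.Construct.Pointwise as Pointwise
open import Tactic.RingSolver using (solve-∀)
open import Tactic.RingSolver.Core.AlmostCommutativeRing
  using (AlmostCommutativeRing; fromCommutativeRing; _-Raw-AlmostCommutative⟶_)
open import Tactic.RingSolver.Core.Polynomial.Parameters using (Homomorphism)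
open import Tactic.RingSolver.Core.Expression using (Expr; Κ; Ι; module Eval)
  renaming (_⊕_ to infixl 6 _⊕ₑ_; _⊗_ to infixl 7 _⊛ₑ_; _⊛_ to infixr 8 _^′ₑ_; ⊝_ to infix 8 ⊖ₑ_)

open ≡-Reasoning

private
  variable
    f f′ : ℕ → ℚ

ℚ-ring : AlmostCommutativeRing 0ℓ 0ℓ
ℚ-ring = fromCommutativeRing ℚ.+-*-commutativeRing 0≟_
  where
  0≟_ : (q : ℚ) → Maybe (0ℚ ≡ q)
  0≟ q with q ℚ.≟ 0ℚ
  ... | yes q≡0 = just (sym q≡0)
  ... | no  _   = nothing

ι : ℕ → ℚ
ι n = fromℤ (ℤ.+ n)

toℚᵘ-/ : ∀ n d .{{_ : ℕ.NonZero d}} → toℚᵘ (ℤ.+ n / d) ≃ᵘ mkℚᵘ (ℤ.+ n) (ℕ.pred d)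
toℚᵘ-/ n (suc d) = ℚ.toℚᵘ-fromℚᵘ (mkℚᵘ (ℤ.+ n) d)

ι-+ : ∀ m n → ι (m ℕ.+ n) ≡ ι m + ι n
ι-+ m n = ℚ.toℚᵘ-injective (ℚᵘ.≃-sym (ℚᵘ.≃-trans (ℚ.toℚᵘ-homo-+ (ι m) (ι n)) (*≡* eq)))
  where
  eq : (ℤ.+ m ℤ.* ℤ.+ 1 ℤ.+ ℤ.+ n ℤ.* ℤ.+ 1) ℤ.* ℤ.+ 1 ≡ ℤ.+ (m ℕ.+ n) ℤ.* ℤ.+ 1
  eq = cong (ℤ._* ℤ.+ 1) (trans (cong₂ ℤ._+_ (ℤ.*-identityʳ (ℤ.+ m)) (ℤ.*-identityʳ (ℤ.+ n))) (sym (ℤ.pos-+ m n)))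

ι-* : ∀ m n → ι (m ℕ.* n) ≡ ι m * ι n
ι-* m n = ℚ.toℚᵘ-injective (ℚᵘ.≃-sym (ℚᵘ.≃-trans (ℚ.toℚᵘ-homo-* (ι m) (ι n)) (*≡* eq)))
  where
  eq : (ℤ.+ m ℤ.* ℤ.+ n) ℤ.* ℤ.+ 1 ≡ ℤ.+ (m ℕ.* n) ℤ.* ℤ.+ 1
  eq = cong (ℤ._* ℤ.+ 1) (sym (ℤ.pos-* m n))

ι-nonZero : ∀ n .{{_ : ℕ.NonZero n}} → ι n ≢ 0ℚ
ι-nonZero (suc n) ()

*-cancelˡ-≡ : ∀ p {q r} → p ≢ 0ℚ → p * q ≡ p * r → q ≡ r
*-cancelˡ-≡ p {q} {r} p≢0 eq = begin
  q               ≡⟨ ℚ.*-identityˡ q ⟨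
  1ℚ * q          ≡⟨ cong (_* q) (ℚ.*-inverseˡ p) ⟨
  1/ p * p * q    ≡⟨ ℚ.*-assoc (1/ p) p q ⟩
  1/ p * (p * q)  ≡⟨ cong (1/ p *_) eq ⟩
  1/ p * (p * r)  ≡⟨ ℚ.*-assoc (1/ p) p r ⟨
  1/ p * p * r    ≡⟨ cong (_* r) (ℚ.*-inverseˡ p) ⟩
  1ℚ * r          ≡⟨ ℚ.*-identityˡ r ⟩
  r               ∎
  where instance _ = ℚ.≢-nonZero p≢0

toℚᵘ-ι-*-/ : ∀ a n d .{{_ : ℕ.NonZero d}} →
  toℚᵘ (ι a * (ℤ.+ n / d)) ≃ᵘ mkℚᵘ (ℤ.+ a) 0 ℚᵘ.* mkℚᵘ (ℤ.+ n) (ℕ.pred d)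
toℚᵘ-ι-*-/ a n d = ℚᵘ.≃-trans (ℚ.toℚᵘ-homo-* (ι a) (ℤ.+ n / d)) (ℚᵘ.*-congˡ {toℚᵘ (ι a)} (toℚᵘ-/ n d))

ι-*-/-cross : ∀ a b {n n′ d d′} .{{_ : ℕ.NonZero d}} .{{_ : ℕ.NonZero d′}} →
  a ℕ.* n′ ℕ.* d ≡ b ℕ.* n ℕ.* d′ → ι a * (ℤ.+ n′ / d′) ≡ ι b * (ℤ.+ n / d)
ι-*-/-cross a b {n} {n′} {d} {d′} eq = ℚ.toℚᵘ-injective
  (ℚᵘ.≃-trans (toℚᵘ-ι-*-/ a n′ d′) (ℚᵘ.≃-trans (*≡* cross) (ℚᵘ.≃-sym (toℚᵘ-ι-*-/ b n d))))
  where
  pos-form : ∀ x y z → (ℤ.+ x ℤ.* ℤ.+ y) ℤ.* ℤ.+ (1 ℕ.* z) ≡ ℤ.+ (x ℕ.* y ℕ.* z)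
  pos-form x y z = trans (cong₂ ℤ._*_ (sym (ℤ.pos-* x y)) (cong ℤ.+_ (ℕ.*-identityˡ z))) (sym (ℤ.pos-* (x ℕ.* y) z))
  cross : (ℤ.+ a ℤ.* ℤ.+ n′) ℤ.* ℤ.+ (1 ℕ.* suc (ℕ.pred d)) ≡ (ℤ.+ b ℤ.* ℤ.+ n) ℤ.* ℤ.+ (1 ℕ.* suc (ℕ.pred d′))
  cross = begin
    (ℤ.+ a ℤ.* ℤ.+ n′) ℤ.* ℤ.+ (1 ℕ.* suc (ℕ.pred d))   ≡⟨ pos-form a n′ _ ⟩
    ℤ.+ (a ℕ.* n′ ℕ.* suc (ℕ.pred d))                   ≡⟨ cong (λ e → ℤ.+ (a ℕ.* n′ ℕ.* e)) (ℕ.suc-pred d) ⟩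
    ℤ.+ (a ℕ.* n′ ℕ.* d)                                ≡⟨ cong ℤ.+_ eq ⟩
    ℤ.+ (b ℕ.* n ℕ.* d′)                                ≡⟨ cong (λ e → ℤ.+ (b ℕ.* n ℕ.* e)) (ℕ.suc-pred d′) ⟨
    ℤ.+ (b ℕ.* n ℕ.* suc (ℕ.pred d′))                   ≡⟨ pos-form b n _ ⟨
    (ℤ.+ b ℤ.* ℤ.+ n) ℤ.* ℤ.+ (1 ℕ.* suc (ℕ.pred d′))   ∎

ι-affine : ∀ a n b → ι (a ℕ.* n ℕ.+ b) ≡ ι a * ι n + ι b
ι-affine a n b = trans (ι-+ (a ℕ.* n) b) (cong (_+ ι b) (ι-* a n))

sumBelow-cong : ∀ n → (∀ k → k < n → f k ≡ f′ k) → sumBelow f n ≡ sumBelow f′ n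
sumBelow-cong zero    eq = refl
sumBelow-cong (suc n) eq = cong₂ _+_ (sumBelow-cong n (λ k k<n → eq k (ℕ.m<n⇒m<1+n k<n))) (eq n ℕ.≤-refl)

sumBelow-zero : ∀ n → (∀ k → k < n → f k ≡ 0ℚ) → sumBelow f n ≡ 0ℚ
sumBelow-zero zero    eq = refl
sumBelow-zero (suc n) eq =
  cong₂ _+_ (sumBelow-zero n (λ k k<n → eq k (ℕ.m<n⇒m<1+n k<n))) (eq n ℕ.≤-refl)

sumBelow-+ : ∀ (f g : ℕ → ℚ) n → sumBelow (λ k → f k + g k) n ≡ sumBelow f n + sumBelow g n
sumBelow-+ f g zero    = refl
sumBelow-+ f g (suc n) = begin
  sumBelow (λ k → f k + g k) n + (f n + g n)       ≡⟨ cong (_+ (f n + g n)) (sumBelow-+ f g n) ⟩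
  (sumBelow f n + sumBelow g n) + (f n + g n)      ≡⟨ interchange (sumBelow f n) (sumBelow g n) (f n) (g n) ⟩
  (sumBelow f n + f n) + (sumBelow g n + g n)      ∎
  where
  interchange : ∀ a b c d → (a + b) + (c + d) ≡ (a + c) + (b + d)
  interchange = solve-∀ ℚ-ring

sumBelow-*ˡ : ∀ c (f : ℕ → ℚ) n → sumBelow (λ k → c * f k) n ≡ c * sumBelow f n
sumBelow-*ˡ c f zero    = sym (ℚ.*-zeroʳ c)
sumBelow-*ˡ c f (suc n) = trans (cong (_+ c * f n) (sumBelow-*ˡ c f n)) (sym (ℚ.*-distribˡ-+ c _ _))

sumBelow-*ʳ : ∀ c (f : ℕ → ℚ) n → sumBelow (λ k → f k * c) n ≡ sumBelow f n * c
sumBelow-*ʳ c f n = begin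
  sumBelow (λ k → f k * c) n  ≡⟨ sumBelow-cong n (λ k _ → ℚ.*-comm (f k) c) ⟩
  sumBelow (λ k → c * f k) n  ≡⟨ sumBelow-*ˡ c f n ⟩
  c * sumBelow f n            ≡⟨ ℚ.*-comm c _ ⟩
  sumBelow f n * c            ∎

sumBelow-suc : ∀ (f : ℕ → ℚ) n → sumBelow f (suc n) ≡ f 0 + sumBelow (f ∘ suc) n
sumBelow-suc f zero    = trans (ℚ.+-identityˡ (f 0)) (sym (ℚ.+-identityʳ (f 0)))
sumBelow-suc f (suc n) = trans (cong (_+ f (suc n)) (sumBelow-suc f n)) (ℚ.+-assoc (f 0) _ _)

sumBelow-reverse : ∀ (f : ℕ → ℚ) n → sumBelow f n ≡ sumBelow (λ k → f (n ∸ suc k)) n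
sumBelow-reverse f zero    = refl
sumBelow-reverse f (suc n) = begin
  sumBelow f n + f n                              ≡⟨ cong (_+ f n) (sumBelow-reverse f n) ⟩
  sumBelow (λ k → f (n ∸ suc k)) n + f n          ≡⟨ ℚ.+-comm _ (f n) ⟩
  f n + sumBelow (λ k → f (n ∸ suc k)) n          ≡⟨ sumBelow-suc (λ k → f (suc n ∸ suc k)) n ⟨
  sumBelow (λ k → f (suc n ∸ suc k)) (suc n)      ∎

sumBelow-triangle : ∀ n (F : ℕ → ℕ → ℚ) →
  sumBelow (λ k → sumBelow (λ j → F j k) (suc k)) n ≡
  sumBelow (λ j → sumBelow (λ i → F j (j ℕ.+ i)) (n ∸ j)) n
sumBelow-triangle zero    F = refl
sumBelow-triangle (suc n) F = begin
  sumBelow (λ k → sumBelow (λ j → F j k) (suc k)) n + (sumBelow (λ j → F j n) n + F n n)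
    ≡⟨ cong (_+ (sumBelow (λ j → F j n) n + F n n)) (sumBelow-triangle n F) ⟩
  rows n + (sumBelow (λ j → F j n) n + F n n)
    ≡⟨ ℚ.+-assoc (rows n) _ _ ⟨
  (rows n + sumBelow (λ j → F j n) n) + F n n
    ≡⟨ cong₂ _+_ (sumBelow-+ (row n) (λ j → F j n) n) lastRow ⟨
  sumBelow (λ j → row n j + F j n) n + row (suc n) n
    ≡⟨ cong (_+ row (suc n) n) (sumBelow-cong n extendRow) ⟩
  rows (suc n) ∎
  where
  row : ℕ → ℕ → ℚ
  row m j = sumBelow (λ i → F j (j ℕ.+ i)) (m ∸ j)
  rows : ℕ → ℚ
  rows m = sumBelow (row m) m
  lastRow : row (suc n) n ≡ F n n
  lastRow rewrite ℕ.+-∸-assoc 1 (ℕ.≤-refl {n}) | ℕ.n∸n≡0 n | ℕ.+-identityʳ n = ℚ.+-identityˡ (F n n)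
  extendRow : ∀ j → j < n → row n j + F j n ≡ row (suc n) j
  extendRow j j<n rewrite ℕ.+-∸-assoc 1 (ℕ.<⇒≤ j<n) =
    cong (λ m → row n j + F j m) (sym (ℕ.m+[n∸m]≡n (ℕ.<⇒≤ j<n)))

infix 8 ⊖_

⊖_ : PowerSeries → PowerSeries
(⊖ f) n = - f n

0ₛ 1ₛ : PowerSeries
0ₛ _ = 0ℚ
1ₛ = const 1ℚ

const-0ℚ : const 0ℚ ≗ 0ₛ
const-0ℚ zero    = refl
const-0ℚ (suc n) = refl

const-⊛ : ∀ c f n → (const c ⊛ f) n ≡ c * f n
const-⊛ c f n = begin
  sumBelow (λ k → const c k * f (n ∸ k)) (suc n)       ≡⟨ sumBelow-suc _ n ⟩
  c * f n + sumBelow (λ k → 0ℚ * f (n ∸ suc k)) n      ≡⟨ cong (c * f n +_) (sumBelow-zero n (λ k _ → ℚ.*-zeroˡ (f (n ∸ suc k)))) ⟩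
  c * f n + 0ℚ                                         ≡⟨ ℚ.+-identityʳ _ ⟩
  c * f n                                              ∎

⊛-cong : ∀ {f f′ g g′} → f ≗ f′ → g ≗ g′ → f ⊛ g ≗ f′ ⊛ g′
⊛-cong f≗f′ g≗g′ n = sumBelow-cong (suc n) (λ k _ → cong₂ _*_ (f≗f′ k) (g≗g′ (n ∸ k)))

⊛-comm : ∀ f g → f ⊛ g ≗ g ⊛ f
⊛-comm f g n = begin
  sumBelow (λ k → f k * g (n ∸ k)) (suc n)                ≡⟨ sumBelow-reverse _ (suc n) ⟩
  sumBelow (λ k → f (n ∸ k) * g (n ∸ (n ∸ k))) (suc n)    ≡⟨ sumBelow-cong (suc n) swap ⟩
  sumBelow (λ k → g k * f (n ∸ k)) (suc n)                ∎
  where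
  swap : ∀ k → k < suc n → f (n ∸ k) * g (n ∸ (n ∸ k)) ≡ g k * f (n ∸ k)
  swap k k<1+n rewrite ℕ.m∸[m∸n]≡n (ℕ.≤-pred k<1+n) = ℚ.*-comm (f (n ∸ k)) (g k)

⊛-assoc : ∀ f g h → (f ⊛ g) ⊛ h ≗ f ⊛ (g ⊛ h)
⊛-assoc f g h n = begin
  sumBelow (λ k → sumBelow (λ j → f j * g (k ∸ j)) (suc k) * h (n ∸ k)) (suc n)
    ≡⟨ sumBelow-cong (suc n) (λ k _ → sym (sumBelow-*ʳ (h (n ∸ k)) _ (suc k))) ⟩
  sumBelow (λ k → sumBelow (λ j → f j * g (k ∸ j) * h (n ∸ k)) (suc k)) (suc n)
    ≡⟨ sumBelow-triangle (suc n) (λ j k → f j * g (k ∸ j) * h (n ∸ k)) ⟩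
  sumBelow (λ j → sumBelow (λ i → f j * g (j ℕ.+ i ∸ j) * h (n ∸ (j ℕ.+ i))) (suc n ∸ j)) (suc n)
    ≡⟨ sumBelow-cong (suc n) factorOut ⟩
  sumBelow (λ j → f j * (g ⊛ h) (n ∸ j)) (suc n) ∎
  where
  factorOut : ∀ j → j < suc n →
    sumBelow (λ i → f j * g (j ℕ.+ i ∸ j) * h (n ∸ (j ℕ.+ i))) (suc n ∸ j) ≡ f j * (g ⊛ h) (n ∸ j)
  factorOut j j<1+n rewrite ℕ.+-∸-assoc 1 (ℕ.≤-pred j<1+n) = begin
    sumBelow (λ i → f j * g (j ℕ.+ i ∸ j) * h (n ∸ (j ℕ.+ i))) (suc (n ∸ j))
      ≡⟨ sumBelow-cong (suc (n ∸ j)) (λ i _ → reassociate i) ⟩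
    sumBelow (λ i → f j * (g i * h (n ∸ j ∸ i))) (suc (n ∸ j))
      ≡⟨ sumBelow-*ˡ (f j) _ (suc (n ∸ j)) ⟩
    f j * (g ⊛ h) (n ∸ j) ∎
    where
    reassociate : ∀ i → f j * g (j ℕ.+ i ∸ j) * h (n ∸ (j ℕ.+ i)) ≡ f j * (g i * h (n ∸ j ∸ i))
    reassociate i rewrite ℕ.m+n∸m≡n j i | ℕ.∸-+-assoc n j i = ℚ.*-assoc (f j) (g i) _

⊛-distribˡ-⊕ : ∀ f g h → f ⊛ (g ⊕ h) ≗ f ⊛ g ⊕ f ⊛ h
⊛-distribˡ-⊕ f g h n = trans
  (sumBelow-cong (suc n) (λ k _ → ℚ.*-distribˡ-+ (f k) (g (n ∸ k)) (h (n ∸ k))))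
  (sumBelow-+ (λ k → f k * g (n ∸ k)) (λ k → f k * h (n ∸ k)) (suc n))

⊛-distribʳ-⊕ : ∀ f g h → (g ⊕ h) ⊛ f ≗ g ⊛ f ⊕ h ⊛ f
⊛-distribʳ-⊕ f g h n = begin
  ((g ⊕ h) ⊛ f) n        ≡⟨ ⊛-comm (g ⊕ h) f n ⟩
  (f ⊛ (g ⊕ h)) n        ≡⟨ ⊛-distribˡ-⊕ f g h n ⟩
  (f ⊛ g) n + (f ⊛ h) n  ≡⟨ cong₂ _+_ (⊛-comm f g n) (⊛-comm f h n) ⟩
  (g ⊛ f) n + (h ⊛ f) n  ∎

⊛-identityˡ : ∀ f → 1ₛ ⊛ f ≗ f
⊛-identityˡ f n = trans (const-⊛ 1ℚ f n) (ℚ.*-identityˡ (f n))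

powerSeries-isCommutativeRing : IsCommutativeRing _≗_ _⊕_ _⊛_ ⊖_ 0ₛ 1ₛ
powerSeries-isCommutativeRing = record
  { isRing = record
    { +-isAbelianGroup = Pointwise.isAbelianGroup ℕ ℚ.+-0-isAbelianGroup
    ; *-cong           = ⊛-cong
    ; *-assoc          = ⊛-assoc
    ; *-identity       = ⊛-identityˡ , λ f n → trans (⊛-comm f 1ₛ n) (⊛-identityˡ f n)
    ; distrib          = ⊛-distribˡ-⊕ , ⊛-distribʳ-⊕
    }
  ; *-comm = ⊛-comm
  }

powerSeriesRing : CommutativeRing 0ℓ 0ℓ
powerSeriesRing = record { isCommutativeRing = powerSeries-isCommutativeRing }

private
  module PS = CommutativeRing powerSeriesRing

⊛-at-0 : ∀ f g → (f ⊛ g) 0 ≡ f 0 * g 0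
⊛-at-0 f g = ℚ.+-identityˡ (f 0 * g 0)

X⊛-at-0 : ∀ f → (X ⊛ f) 0 ≡ 0ℚ
X⊛-at-0 f = trans (⊛-at-0 X f) (ℚ.*-zeroˡ (f 0))

X⊛-at-suc : ∀ f n → (X ⊛ f) (suc n) ≡ f n
X⊛-at-suc f n = begin
  sumBelow (λ k → X k * f (suc n ∸ k)) (suc (suc n))
    ≡⟨ sumBelow-suc _ (suc n) ⟩
  0ℚ * f (suc n) + sumBelow (λ k → X (suc k) * f (n ∸ k)) (suc n)
    ≡⟨ cong₂ _+_ (ℚ.*-zeroˡ (f (suc n))) (sumBelow-suc (λ k → X (suc k) * f (n ∸ k)) n) ⟩
  0ℚ + (1ℚ * f n + sumBelow (λ k → 0ℚ * f (n ∸ suc k)) n)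
    ≡⟨ ℚ.+-identityˡ _ ⟩
  1ℚ * f n + sumBelow (λ k → 0ℚ * f (n ∸ suc k)) n
    ≡⟨ cong₂ _+_ (ℚ.*-identityˡ (f n)) (sumBelow-zero n (λ k _ → ℚ.*-zeroˡ (f (n ∸ suc k)))) ⟩
  f n + 0ℚ
    ≡⟨ ℚ.+-identityʳ (f n) ⟩
  f n ∎

⊛≗0⇒≗0 : ∀ {a f} → a 0 ≢ 0ℚ → a ⊛ f ≗ 0ₛ → f ≗ 0ₛ
⊛≗0⇒≗0 {a} {f} a₀≢0 a⊛f≗0 = <-rec (λ n → f n ≡ 0ℚ) step
  where
  step : ∀ n → (∀ {m} → m < n → f m ≡ 0ℚ) → f n ≡ 0ℚ
  step n ih = *-cancelˡ-≡ (a 0) a₀≢0 (begin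
    a 0 * f n                                             ≡⟨ ℚ.*-comm (a 0) (f n) ⟩
    f n * a 0                                             ≡⟨ cong (λ m → f n * a m) (ℕ.n∸n≡0 n) ⟨
    f n * a (n ∸ n)                                       ≡⟨ ℚ.+-identityˡ _ ⟨
    0ℚ + f n * a (n ∸ n)                                  ≡⟨ cong (_+ f n * a (n ∸ n)) lowerTerms ⟨
    sumBelow (λ k → f k * a (n ∸ k)) n + f n * a (n ∸ n)  ≡⟨ ⊛-comm f a n ⟩
    (a ⊛ f) n                                             ≡⟨ a⊛f≗0 n ⟩
    0ℚ                                                    ≡⟨ ℚ.*-zeroʳ (a 0) ⟨
    a 0 * 0ℚ                                              ∎)
    where
    lowerTerms : sumBelow (λ k → f k * a (n ∸ k)) n ≡ 0ℚ
    lowerTerms = sumBelow-zero n (λ k k<n → trans (cong (_* a (n ∸ k)) (ih k<n)) (ℚ.*-zeroˡ (a (n ∸ k))))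

⊛-cancelˡ : ∀ {a f g} → a 0 ≢ 0ℚ → a ⊛ f ≗ a ⊛ g → f ≗ g
⊛-cancelˡ {a} {f} {g} a₀≢0 af≗ag = f≗g
  where
  open import Algebra.Properties.Ring PS.ring using (-‿distribʳ-*)
  a⊛[f-g]≗0 : a ⊛ (f ⊕ ⊖ g) ≗ 0ₛ
  a⊛[f-g]≗0 = PS.trans (⊛-distribˡ-⊕ a f (⊖ g))
    (PS.trans (PS.+-cong af≗ag (PS.sym (-‿distribʳ-* a g))) (PS.-‿inverseʳ (a ⊛ g)))
  f-g≗0 : f ⊕ ⊖ g ≗ 0ₛ
  f-g≗0 = ⊛≗0⇒≗0 {a} a₀≢0 a⊛[f-g]≗0
  f≗g : f ≗ g
  f≗g n = begin
    f n                   ≡⟨ ℚ.+-identityʳ (f n) ⟨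
    f n + 0ℚ              ≡⟨ cong (f n +_) (ℚ.+-inverseˡ (g n)) ⟨
    f n + (- g n + g n)   ≡⟨ ℚ.+-assoc (f n) _ _ ⟨
    (f n + - g n) + g n   ≡⟨ cong (_+ g n) (f-g≗0 n) ⟩
    0ℚ + g n              ≡⟨ ℚ.+-identityˡ (g n) ⟩
    g n                   ∎

-- Polynomial identities between power series

powerSeriesAlmostCommutativeRing : AlmostCommutativeRing 0ℓ 0ℓ
powerSeriesAlmostCommutativeRing = fromCommutativeRing powerSeriesRing (λ _ → nothing)

const-homomorphism : ℚ.+-*-rawRing -Raw-AlmostCommutative⟶ powerSeriesAlmostCommutativeRing
const-homomorphism = record
  { ⟦_⟧    = const
  ; +-homo = λ { a b zero → refl ; a b (suc n) → sym (ℚ.+-identityˡ 0ℚ) }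
  ; *-homo = λ a b n → trans (const-* a b n) (sym (const-⊛ a (const b) n))
  ; -‿homo = λ { a zero → refl ; a (suc n) → refl }
  ; 0-homo = const-0ℚ
  ; 1-homo = λ n → refl
  }
  where
  const-* : ∀ a b → const (a * b) ≗ λ n → a * const b n
  const-* a b zero    = refl
  const-* a b (suc n) = sym (ℚ.*-zeroʳ a)

rationalCoefficients : Homomorphism 0ℓ 0ℓ 0ℓ 0ℓ
rationalCoefficients = record
  { from          = record { rawRing = ℚ.+-*-rawRing ; isZero = λ q → does (q ℚ.≟ 0ℚ) }
  ; to            = powerSeriesAlmostCommutativeRing
  ; morphism      = const-homomorphism
  ; Zero-C⟶Zero-R = const-zero
  }
  where
  const-zero : ∀ q → T (does (q ℚ.≟ 0ℚ)) → 0ₛ ≗ const q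
  const-zero q isZero with q ℚ.≟ 0ℚ
  ... | yes refl = sym ∘ const-0ℚ
  ... | no  _    = ⊥-elim isZero

Env : ℕ → Set
Env = Vec PowerSeries

open Eval (AlmostCommutativeRing.rawRing powerSeriesAlmostCommutativeRing) const public
open import Algebra.Definitions.RawSemiring (AlmostCommutativeRing.rawSemiring powerSeriesAlmostCommutativeRing) using (_^′_)

module _ where
  open import Tactic.RingSolver.Core.Polynomial.Base (Homomorphism.from rationalCoefficients)
    using (Poly; _⊞_; _⊠_; ⊟_; _⊡_) renaming (κ to κₚ; ι to ιₚ)
  open import Tactic.RingSolver.Core.Polynomial.Semantics rationalCoefficients
    renaming (⟦_⟧ to ⟦_⟧ₚ)
  open import Tactic.RingSolver.Core.Polynomial.Homomorphism rationalCoefficients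
  open import Algebra.Properties.Semiring.Exp.TCOptimised (AlmostCommutativeRing.semiring powerSeriesAlmostCommutativeRing)
    using (^-congˡ)
  open AlmostCommutativeRing powerSeriesAlmostCommutativeRing using (+-cong; *-cong; -‿cong) renaming (trans to ≗-trans)

  -- As in Tactic.RingSolver.NonReflective, but with coefficients in ℚ rather than in the ring
  -- itself, so that normal forms of power-series polynomials are decided by computation.
  normalise : ∀ {n} → Expr ℚ n → Poly n
  normalise (Κ x)     = κₚ x
  normalise (Ι x)     = ιₚ x
  normalise (x ⊕ₑ y)  = normalise x ⊞ normalise y
  normalise (x ⊛ₑ y)  = normalise x ⊠ normalise y
  normalise (⊖ₑ x)    = ⊟ normalise x
  normalise (x ^′ₑ i) = normalise x ⊡ i

  normalise-correct : ∀ {n} (e : Expr ℚ n) ρ → ⟦ normalise e ⟧ₚ ρ ≗ ⟦ e ⟧ ρ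
  normalise-correct (Κ x)     ρ = κ-hom x ρ
  normalise-correct (Ι x)     ρ = ι-hom x ρ
  normalise-correct (x ⊕ₑ y)  ρ = ≗-trans (⊞-hom (normalise x) (normalise y) ρ)
                                    (+-cong (normalise-correct x ρ) (normalise-correct y ρ))
  normalise-correct (x ⊛ₑ y)  ρ = ≗-trans (⊠-hom (normalise x) (normalise y) ρ)
                                    (*-cong (normalise-correct x ρ) (normalise-correct y ρ))
  normalise-correct (⊖ₑ x)    ρ = ≗-trans (⊟-hom (normalise x) ρ) (-‿cong (normalise-correct x ρ))
  normalise-correct (x ^′ₑ i) ρ = ≗-trans (⊡-hom (normalise x) i ρ) (^-congˡ i (normalise-correct x ρ))

  ≗-by-normalise : ∀ {n} (ρ : Env n) (e₁ e₂ : Expr ℚ n) → normalise e₁ ≡ normalise e₂ → ⟦ e₁ ⟧ ρ ≗ ⟦ e₂ ⟧ ρ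
  ≗-by-normalise ρ e₁ e₂ eq k = begin
    ⟦ e₁ ⟧ ρ k                     ≡⟨ normalise-correct e₁ ρ k ⟨
    ⟦ normalise e₁ ⟧ₚ ρ k          ≡⟨ cong (λ p → ⟦ p ⟧ₚ ρ k) eq ⟩
    ⟦ normalise e₂ ⟧ₚ ρ k          ≡⟨ normalise-correct e₂ ρ k ⟩
    ⟦ e₂ ⟧ ρ k                     ∎

  ⟦⟧-cong : ∀ {n} (e : Expr ℚ n) {ρ ρ′ : Env n} → (∀ i → lookup ρ i ≗ lookup ρ′ i) → ⟦ e ⟧ ρ ≗ ⟦ e ⟧ ρ′
  ⟦⟧-cong (Κ c)     ρ≗ρ′ = λ _ → refl
  ⟦⟧-cong (Ι i)     ρ≗ρ′ = ρ≗ρ′ i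
  ⟦⟧-cong (a ⊕ₑ b)  ρ≗ρ′ = +-cong (⟦⟧-cong a ρ≗ρ′) (⟦⟧-cong b ρ≗ρ′)
  ⟦⟧-cong (a ⊛ₑ b)  ρ≗ρ′ = ⊛-cong (⟦⟧-cong a ρ≗ρ′) (⟦⟧-cong b ρ≗ρ′)
  ⟦⟧-cong (⊖ₑ a)    ρ≗ρ′ = -‿cong (⟦⟧-cong a ρ≗ρ′)
  ⟦⟧-cong (a ^′ₑ k) ρ≗ρ′ = ^-congˡ k (⟦⟧-cong a ρ≗ρ′)

record Equation {n} (ρ : Env n) : Set where
  constructor equation
  field
    left right : Expr ℚ n
    holds       : ⟦ left ⟧ ρ ≗ ⟦ right ⟧ ρ

Certificate : ∀ {n} → Env n → Set
Certificate {n} ρ = List (Expr ℚ n × Equation ρ)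

weightedSum : ∀ {n} {ρ : Env n} → Certificate ρ → Expr ℚ n
weightedSum []                          = Κ 0ℚ
weightedSum ((c , equation l r _) ∷ cs) = c ⊛ₑ (l ⊕ₑ ⊖ₑ r) ⊕ₑ weightedSum cs

weightedSum≗0 : ∀ {n} {ρ : Env n} (cs : Certificate ρ) → ⟦ weightedSum cs ⟧ ρ ≗ 0ₛ
weightedSum≗0 []                                          = const-0ℚ
weightedSum≗0 {ρ = ρ} ((c , equation l r l≗r) ∷ cs) =
  PS.trans (PS.+-cong (PS.trans (PS.*-cong (PS.refl {⟦ c ⟧ ρ}) l-r≗0) (PS.zeroʳ (⟦ c ⟧ ρ))) (weightedSum≗0 cs))
           (PS.+-identityʳ 0ₛ)
  where
  l-r≗0 : ⟦ l ⟧ ρ ⊕ ⊖ ⟦ r ⟧ ρ ≗ 0ₛ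
  l-r≗0 = PS.trans (PS.+-cong l≗r (PS.refl {⊖ ⟦ r ⟧ ρ})) (PS.-‿inverseʳ (⟦ r ⟧ ρ))

-- The multipliers in a certificate are found by computer algebra.
≗-by-certificate : ∀ {n} (ρ : Env n) (e₁ e₂ : Expr ℚ n) (cs : Certificate ρ) →
  normalise e₁ ≡ normalise (e₂ ⊕ₑ weightedSum cs) → ⟦ e₁ ⟧ ρ ≗ ⟦ e₂ ⟧ ρ
≗-by-certificate ρ e₁ e₂ cs eq k = begin
  ⟦ e₁ ⟧ ρ k                                  ≡⟨ ≗-by-normalise ρ e₁ (e₂ ⊕ₑ weightedSum cs) eq k ⟩
  ⟦ e₂ ⟧ ρ k + ⟦ weightedSum cs ⟧ ρ k         ≡⟨ cong (⟦ e₂ ⟧ ρ k +_) (weightedSum≗0 cs k) ⟩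
  ⟦ e₂ ⟧ ρ k + 0ℚ                             ≡⟨ ℚ.+-identityʳ _ ⟩
  ⟦ e₂ ⟧ ρ k                                  ∎

PowerFree : ∀ {n} → Expr ℚ n → Set
PowerFree (Κ _)      = ⊤
PowerFree (Ι _)      = ⊤
PowerFree (a ⊕ₑ b)   = PowerFree a × PowerFree b
PowerFree (a ⊛ₑ b)   = PowerFree a × PowerFree b
PowerFree (⊖ₑ a)     = PowerFree a
PowerFree (a ^′ₑ k)  = ⊥

module ℚ-Eval = Eval ℚ.+-*-rawRing id

⟦⟧-at-0 : ∀ {n} (e : Expr ℚ n) (ρ : Env n) → PowerFree e → ⟦ e ⟧ ρ 0 ≡ ℚ-Eval.⟦ e ⟧ (map (_$ 0) ρ)
⟦⟧-at-0 (Κ c)    ρ _          = refl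
⟦⟧-at-0 (Ι i)    ρ _          = sym (Vec.lookup-map i (_$ 0) ρ)
⟦⟧-at-0 (a ⊕ₑ b) ρ (pa , pb)  = cong₂ _+_ (⟦⟧-at-0 a ρ pa) (⟦⟧-at-0 b ρ pb)
⟦⟧-at-0 (a ⊛ₑ b) ρ (pa , pb)  = trans (⊛-at-0 (⟦ a ⟧ ρ) (⟦ b ⟧ ρ)) (cong₂ _*_ (⟦⟧-at-0 a ρ pa) (⟦⟧-at-0 b ρ pb))
⟦⟧-at-0 (⊖ₑ a)   ρ pa         = cong -_ (⟦⟧-at-0 a ρ pa)

-- The Euler derivation θ = x d/dx

θ : PowerSeries → PowerSeries
θ f n = ι n * f n

θ-cong : ∀ {f g} → f ≗ g → θ f ≗ θ g
θ-cong f≗g n = cong (ι n *_) (f≗g n)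

θ-⊕ : ∀ f g → θ (f ⊕ g) ≗ θ f ⊕ θ g
θ-⊕ f g n = ℚ.*-distribˡ-+ (ι n) (f n) (g n)

θ-⊖ : ∀ f → θ (⊖ f) ≗ ⊖ θ f
θ-⊖ f n = sym (ℚ.neg-distribʳ-* (ι n) (f n))

θ-const : ∀ c → θ (const c) ≗ const 0ℚ
θ-const c zero    = ℚ.*-zeroˡ c
θ-const c (suc n) = ℚ.*-zeroʳ (ι (suc n))

θ-X : θ X ≗ X
θ-X zero          = refl
θ-X (suc zero)    = refl
θ-X (suc (suc n)) = ℚ.*-zeroʳ (ι (suc (suc n)))

θ-⊛ : ∀ f g → θ (f ⊛ g) ≗ θ f ⊛ g ⊕ f ⊛ θ g
θ-⊛ f g n = begin
  ι n * sumBelow (λ k → f k * g (n ∸ k)) (suc n)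
    ≡⟨ sumBelow-*ˡ (ι n) _ (suc n) ⟨
  sumBelow (λ k → ι n * (f k * g (n ∸ k))) (suc n)
    ≡⟨ sumBelow-cong (suc n) (λ k k≤n → leibniz k (ℕ.≤-pred k≤n)) ⟩
  sumBelow (λ k → ι k * f k * g (n ∸ k) + f k * (ι (n ∸ k) * g (n ∸ k))) (suc n)
    ≡⟨ sumBelow-+ _ _ (suc n) ⟩
  (θ f ⊛ g ⊕ f ⊛ θ g) n ∎
  where
  distribute : ∀ a b x y → (a + b) * (x * y) ≡ a * x * y + x * (b * y)
  distribute = solve-∀ ℚ-ring
  leibniz : ∀ k → k ≤ n → ι n * (f k * g (n ∸ k)) ≡ ι k * f k * g (n ∸ k) + f k * (ι (n ∸ k) * g (n ∸ k))
  leibniz k k≤n = begin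
    ι n * (f k * g (n ∸ k))                 ≡⟨ cong (λ m → ι m * (f k * g (n ∸ k))) (ℕ.m+[n∸m]≡n k≤n) ⟨
    ι (k ℕ.+ (n ∸ k)) * (f k * g (n ∸ k))   ≡⟨ cong (_* (f k * g (n ∸ k))) (ι-+ k (n ∸ k)) ⟩
    (ι k + ι (n ∸ k)) * (f k * g (n ∸ k))   ≡⟨ distribute (ι k) (ι (n ∸ k)) (f k) (g (n ∸ k)) ⟩
    ι k * f k * g (n ∸ k) + f k * (ι (n ∸ k) * g (n ∸ k)) ∎

weaken : ∀ {n} → Expr ℚ n → Expr ℚ (n ℕ.+ n)
weaken {n} (Ι i) = Ι (i ↑ˡ n)
weaken (Κ c)     = Κ c
weaken (a ⊕ₑ b)  = weaken a ⊕ₑ weaken b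
weaken (a ⊛ₑ b)  = weaken a ⊛ₑ weaken b
weaken (⊖ₑ a)    = ⊖ₑ weaken a
weaken (a ^′ₑ k) = weaken a ^′ₑ k

-- Variable n + i of the result stands for θ of variable i; meaningless on powers, see θ-⟦⟧.
θₑ : ∀ {n} → Expr ℚ n → Expr ℚ (n ℕ.+ n)
θₑ {n} (Ι i) = Ι (n ↑ʳ i)
θₑ (Κ c)     = Κ 0ℚ
θₑ (a ⊕ₑ b)  = θₑ a ⊕ₑ θₑ b
θₑ (a ⊛ₑ b)  = θₑ a ⊛ₑ weaken b ⊕ₑ weaken a ⊛ₑ θₑ b
θₑ (⊖ₑ a)    = ⊖ₑ θₑ a
θₑ (a ^′ₑ k) = Κ 0ℚ

⟦weaken⟧ : ∀ {n} (e : Expr ℚ n) (ρ ρ′ : Env n) → ⟦ weaken e ⟧ (ρ ++ ρ′) ≡ ⟦ e ⟧ ρ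
⟦weaken⟧ (Ι i)     ρ ρ′ = Vec.lookup-++ˡ ρ ρ′ i
⟦weaken⟧ (Κ c)     ρ ρ′ = refl
⟦weaken⟧ (a ⊕ₑ b)  ρ ρ′ = cong₂ _⊕_ (⟦weaken⟧ a ρ ρ′) (⟦weaken⟧ b ρ ρ′)
⟦weaken⟧ (a ⊛ₑ b)  ρ ρ′ = cong₂ _⊛_ (⟦weaken⟧ a ρ ρ′) (⟦weaken⟧ b ρ ρ′)
⟦weaken⟧ (⊖ₑ a)    ρ ρ′ = cong ⊖_ (⟦weaken⟧ a ρ ρ′)
⟦weaken⟧ (a ^′ₑ k) ρ ρ′ = cong (_^′ k) (⟦weaken⟧ a ρ ρ′)

θ-⟦⟧ : ∀ {n} (e : Expr ℚ n) (ρ : Env n) → PowerFree e → θ (⟦ e ⟧ ρ) ≗ ⟦ θₑ e ⟧ (ρ ++ map θ ρ)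
θ-⟦⟧ (Ι i)    ρ _         = λ k → cong (_$ k) (sym (trans (Vec.lookup-++ʳ ρ (map θ ρ) i) (Vec.lookup-map i θ ρ)))
θ-⟦⟧ (Κ c)    ρ _         = θ-const c
θ-⟦⟧ (a ⊕ₑ b) ρ (pa , pb) = PS.trans (θ-⊕ (⟦ a ⟧ ρ) (⟦ b ⟧ ρ)) (PS.+-cong (θ-⟦⟧ a ρ pa) (θ-⟦⟧ b ρ pb))
θ-⟦⟧ (a ⊛ₑ b) ρ (pa , pb) = PS.trans (θ-⊛ (⟦ a ⟧ ρ) (⟦ b ⟧ ρ))
  (PS.+-cong (⊛-cong (θ-⟦⟧ a ρ pa) (PS.reflexive (sym (⟦weaken⟧ b ρ (map θ ρ)))))
             (⊛-cong (PS.reflexive (sym (⟦weaken⟧ a ρ (map θ ρ)))) (θ-⟦⟧ b ρ pb)))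
θ-⟦⟧ (⊖ₑ a)   ρ pa        = PS.trans (θ-⊖ (⟦ a ⟧ ρ)) (PS.-‿cong (θ-⟦⟧ a ρ pa))

weaken-equation : ∀ {n} {ρ : Env n} (ρ′ : Env n) → Equation ρ → Equation (ρ ++ ρ′)
weaken-equation {ρ = ρ} ρ′ (equation l r l≗r) = equation (weaken l) (weaken r) λ k → begin
  ⟦ weaken l ⟧ (ρ ++ ρ′) k  ≡⟨ cong (_$ k) (⟦weaken⟧ l ρ ρ′) ⟩
  ⟦ l ⟧ ρ k                 ≡⟨ l≗r k ⟩
  ⟦ r ⟧ ρ k                 ≡⟨ cong (_$ k) (⟦weaken⟧ r ρ ρ′) ⟨
  ⟦ weaken r ⟧ (ρ ++ ρ′) k  ∎

θ-equation : ∀ {n} {ρ : Env n} (eq : Equation ρ) →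
  PowerFree (Equation.left eq) → PowerFree (Equation.right eq) → Equation (ρ ++ map θ ρ)
θ-equation {ρ = ρ} (equation l r l≗r) pl pr = equation (θₑ l) (θₑ r)
  (PS.trans (PS.sym (θ-⟦⟧ l ρ pl)) (PS.trans (θ-cong l≗r) (θ-⟦⟧ r ρ pr)))

-- Fixed points of causal maps

AgreeBelow : ℕ → PowerSeries → PowerSeries → Set
AgreeBelow n f g = ∀ k → k < n → f k ≡ g k

Causal : (PowerSeries → PowerSeries) → Set
Causal Φ = ∀ {n f g} → AgreeBelow n f g → AgreeBelow (suc n) (Φ f) (Φ g)

module FixedPoint (Φ : PowerSeries → PowerSeries) (causal : Causal Φ) where

  iterate : ℕ → PowerSeries
  iterate zero    = 0ₛ
  iterate (suc n) = Φ (iterate n)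

  iterate-agree : ∀ {m n} → m ≤ n → AgreeBelow m (iterate m) (iterate n)
  iterate-agree {zero}          _         k ()
  iterate-agree {suc m} {suc n} (s≤s m≤n) = causal (iterate-agree m≤n)

  -- The n-th coefficient is frozen from the (n + 1)-st iterate on.
  fix : PowerSeries
  fix n = iterate (suc n) n

  fix-agree : ∀ n → AgreeBelow n fix (iterate n)
  fix-agree n k k<n = iterate-agree k<n k ℕ.≤-refl

  fix-isFixedPoint : fix ≗ Φ fix
  fix-isFixedPoint n = sym (causal (fix-agree n) n ℕ.≤-refl)

AgreeBelow-⊕ : ∀ {n f f′ g g′} → AgreeBelow n f f′ → AgreeBelow n g g′ → AgreeBelow n (f ⊕ g) (f′ ⊕ g′)
AgreeBelow-⊕ f≈f′ g≈g′ k k<n = cong₂ _+_ (f≈f′ k k<n) (g≈g′ k k<n)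

AgreeBelow-⊛ : ∀ {n f f′ g g′} → AgreeBelow n f f′ → AgreeBelow n g g′ → AgreeBelow n (f ⊛ g) (f′ ⊛ g′)
AgreeBelow-⊛ f≈f′ g≈g′ k k<n = sumBelow-cong (suc k) λ j j≤k →
  cong₂ _*_ (f≈f′ j (ℕ.≤-<-trans (ℕ.≤-pred j≤k) k<n)) (g≈g′ (k ∸ j) (ℕ.≤-<-trans (ℕ.m∸n≤m k j) k<n))

AgreeBelow-^ˢ : ∀ {n f f′} k → AgreeBelow n f f′ → AgreeBelow n (f ^ˢ k) (f′ ^ˢ k)
AgreeBelow-^ˢ zero    f≈f′ k _ = refl
AgreeBelow-^ˢ (suc j) f≈f′     = AgreeBelow-⊛ f≈f′ (AgreeBelow-^ˢ j f≈f′)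

X⊛-causal : Causal (X ⊛_)
X⊛-causal {f = f} {g} f≈g zero    _         = trans (X⊛-at-0 f) (sym (X⊛-at-0 g))
X⊛-causal {f = f} {g} f≈g (suc k) (s≤s k<n) = trans (X⊛-at-suc f k) (trans (f≈g k k<n) (sym (X⊛-at-suc g k)))

infixr 8 _^ₑ_
infix 8 1+ₑ_ 1-3ₑ_

-- Unlike the solver's own exponentiation, this evaluates to `_^ˢ_`.
_^ₑ_ : ∀ {n} → Expr ℚ n → ℕ → Expr ℚ n
e ^ₑ zero  = Κ 1ℚ
e ^ₑ suc k = e ⊛ₑ e ^ₑ k

1+ₑ_ 1-3ₑ_ : ∀ {n} → Expr ℚ n → Expr ℚ n
1+ₑ e  = Κ 1ℚ ⊕ₑ e
1-3ₑ e = Κ 1ℚ ⊕ₑ Κ (- ι 3) ⊛ₑ e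

horner : ∀ {n} → List ℚ → Expr ℚ n → Expr ℚ n
horner []       e = Κ 0ℚ
horner (c ∷ cs) e = Κ c ⊕ₑ e ⊛ₑ horner cs e

v₀ : ∀ {n} → Expr ℚ (1 ℕ.+ n)
v₁ : ∀ {n} → Expr ℚ (2 ℕ.+ n)
v₂ : ∀ {n} → Expr ℚ (3 ℕ.+ n)
v₃ : ∀ {n} → Expr ℚ (4 ℕ.+ n)
v₄ : ∀ {n} → Expr ℚ (5 ℕ.+ n)
v₅ : ∀ {n} → Expr ℚ (6 ℕ.+ n)
v₀ = Ι 0F
v₁ = Ι 1F
v₂ = Ι 2F
v₃ = Ι 3F
v₄ = Ι 4F
v₅ = Ι 5F

Φ : PowerSeries → PowerSeries
Φ f = X ⊛ (1ₛ ⊕ f) ^ˢ 4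

Φ-causal : Causal Φ
Φ-causal f≈g = X⊛-causal (AgreeBelow-^ˢ 4 (AgreeBelow-⊕ {f = 1ₛ} (λ _ _ → refl) f≈g))

u : PowerSeries
u = FixedPoint.fix Φ Φ-causal

u-equation : Equation (X ∷ u ∷ [])
u-equation = equation v₁ (v₀ ⊛ₑ (1+ₑ v₁) ^ₑ 4) (FixedPoint.fix-isFixedPoint Φ Φ-causal)

u-at-0 : u 0 ≡ 0ℚ
u-at-0 = trans (Equation.holds u-equation 0) (X⊛-at-0 ((1ₛ ⊕ u) ^ˢ 4))

hₑ : ∀ {n} → Expr ℚ n → Expr ℚ n
hₑ e = e ⊕ₑ ⊖ₑ e ^ₑ 2 ⊕ₑ ⊖ₑ e ^ₑ 3

h : PowerSeries
h = ⟦ hₑ v₀ ⟧ (u ∷ [])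

h-at-0 : h 0 ≡ 0ℚ
h-at-0 = trans (⟦⟧-at-0 (hₑ v₀) (u ∷ []) _) (cong (λ c → ℚ-Eval.⟦ hₑ v₀ ⟧ (c ∷ [])) u-at-0)

lhsₑ : ∀ {n} → Expr ℚ n → Expr ℚ n → Expr ℚ n
lhsₑ x y =
     x ⊛ₑ (x ^ₑ 2 ⊕ₑ Κ (ι 11) ⊛ₑ x ⊕ₑ Κ (- ι 1))
  ⊕ₑ (Κ (ι 4) ⊛ₑ x ^ₑ 3 ⊕ₑ Κ (ι 25) ⊛ₑ x ^ₑ 2 ⊕ₑ Κ (- ι 14) ⊛ₑ x ⊕ₑ Κ (ι 1)) ⊛ₑ y
  ⊕ₑ x ⊛ₑ (Κ (ι 6) ⊛ₑ x ^ₑ 2 ⊕ₑ Κ (ι 17) ⊛ₑ x ⊕ₑ Κ (ι 3)) ⊛ₑ y ^ₑ 2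
  ⊕ₑ x ^ₑ 2 ⊛ₑ (Κ (ι 4) ⊛ₑ x ⊕ₑ Κ (ι 3)) ⊛ₑ y ^ₑ 3
  ⊕ₑ x ^ₑ 3 ⊛ₑ y ^ₑ 4

lhs-h : lhs h ≗ 0ₛ
lhs-h = PS.trans
  (≗-by-certificate (X ∷ u ∷ []) (lhsₑ v₀ (hₑ v₁)) (Κ 0ℚ) ((multiplier , u-equation) ∷ []) refl) const-0ℚ
  where
  multiplier : Expr ℚ 2
  multiplier = horner (ι 1 ∷ - ι 1 ∷ - ι 1 ∷ []) v₁
    ⊕ₑ v₀ ⊛ₑ horner (- ι 11 ∷ ι 18 ∷ ι 2 ∷ - ι 12 ∷ ι 1 ∷ ι 2 ∷ []) v₁
    ⊕ₑ v₀ ⊛ₑ v₀ ⊛ₑ horner (- ι 1 ∷ ι 0 ∷ ι 4 ∷ ι 0 ∷ - ι 6 ∷ ι 0 ∷ ι 4 ∷ ι 0 ∷ - ι 1 ∷ []) v₁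

-- A differential equation for h

-- Differentiating u = x (1 + u)⁴ gives θu (1 + u) = u (1 + u) + 4 u θu.
θu-equation : ⟦ 1-3ₑ v₀ ⊛ₑ v₁ ⟧ (u ∷ θ u ∷ []) ≗ ⟦ v₀ ⊛ₑ 1+ₑ v₀ ⟧ (u ∷ θ u ∷ [])
θu-equation = ≗-by-certificate (X ∷ u ∷ θ X ∷ θ u ∷ []) (1-3ₑ v₁ ⊛ₑ v₃) (v₁ ⊛ₑ 1+ₑ v₁)
  ( (1+ₑ v₁ , θ-equation u-equation _ _)
  ∷ ((1+ₑ v₁) ^ₑ 5 , equation v₂ v₀ θ-X)
  ∷ (⊖ₑ (1+ₑ v₁ ⊕ₑ Κ (ι 4) ⊛ₑ v₃) , weaken-equation (map θ (X ∷ u ∷ [])) u-equation)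
  ∷ []) refl

θu-equation-in : ∀ f g → Equation (u ∷ f ∷ θ u ∷ g ∷ [])
θu-equation-in f g = equation (1-3ₑ v₀ ⊛ₑ v₂) (v₀ ⊛ₑ 1+ₑ v₀) θu-equation

numerator₁ numerator₂ numerator₃ numerator₄ : ∀ {n} → Expr ℚ n → Expr ℚ n
numerator₁ = horner (ι 0 ∷ ι 1 ∷ ι 2 ∷ ι 1 ∷ [])
numerator₂ = horner (ι 0 ∷ ι 1 ∷ ι 5 ∷ ι 7 ∷ ι 3 ∷ [])
numerator₃ = horner (ι 0 ∷ ι 1 ∷ ι 11 ∷ ι 16 ∷ - ι 24 ∷ - ι 57 ∷ - ι 27 ∷ [])
numerator₄ = horner (ι 0 ∷ ι 1 ∷ ι 29 ∷ ι 109 ∷ - ι 15 ∷ - ι 309 ∷ - ι 33 ∷ ι 423 ∷ ι 243 ∷ [])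

h-equation : Equation (u ∷ h ∷ [])
h-equation = equation v₁ (hₑ v₀) (λ _ → refl)

θ¹h-equation : Equation (u ∷ θ h ∷ [])
θ¹h-equation = equation v₁ (numerator₁ v₀) (≗-by-certificate
  (u ∷ h ∷ θ u ∷ θ h ∷ []) v₃ (numerator₁ v₀)
  ( (Κ (ι 1) , θ-equation h-equation _ _)
  ∷ (1+ₑ v₀ , θu-equation-in h (θ h))
  ∷ []) refl)

θ²h-equation : Equation (u ∷ θ (θ h) ∷ [])
θ²h-equation = equation (1-3ₑ v₀ ⊛ₑ v₁) (numerator₂ v₀) (≗-by-certificate
  (u ∷ θ h ∷ θ u ∷ θ (θ h) ∷ []) (1-3ₑ v₀ ⊛ₑ v₃) (numerator₂ v₀)
  ( (1-3ₑ v₀ , θ-equation θ¹h-equation _ _)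
  ∷ (horner (ι 1 ∷ ι 4 ∷ ι 3 ∷ []) v₀ , θu-equation-in (θ h) (θ (θ h)))
  ∷ []) refl)

θ³h-equation : Equation (u ∷ θ (θ (θ h)) ∷ [])
θ³h-equation = equation ((1-3ₑ v₀) ^ₑ 3 ⊛ₑ v₁) (numerator₃ v₀) (≗-by-certificate
  (u ∷ θ (θ h) ∷ θ u ∷ θ (θ (θ h)) ∷ []) ((1-3ₑ v₀) ^ₑ 3 ⊛ₑ v₃) (numerator₃ v₀)
  ( ((1-3ₑ v₀) ^ₑ 2 , θ-equation θ²h-equation _ _)
  ∷ (Κ (ι 3) ⊛ₑ 1-3ₑ v₀ ⊛ₑ v₁ ⊕ₑ 1-3ₑ v₀ ⊛ₑ horner (ι 1 ∷ ι 10 ∷ ι 21 ∷ ι 12 ∷ []) v₀ , θu-equation-in (θ (θ h)) (θ (θ (θ h))))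
  ∷ (Κ (ι 3) ⊛ₑ v₀ ⊛ₑ 1+ₑ v₀ , weaken-equation (map θ (u ∷ θ (θ h) ∷ [])) θ²h-equation)
  ∷ []) refl)

θ⁴h-equation : Equation (u ∷ θ (θ (θ (θ h))) ∷ [])
θ⁴h-equation = equation ((1-3ₑ v₀) ^ₑ 5 ⊛ₑ v₁) (numerator₄ v₀) (≗-by-certificate
  (u ∷ θ (θ (θ h)) ∷ θ u ∷ θ (θ (θ (θ h))) ∷ []) ((1-3ₑ v₀) ^ₑ 5 ⊛ₑ v₃) (numerator₄ v₀)
  ( ((1-3ₑ v₀) ^ₑ 2 , θ-equation θ³h-equation _ _)
  ∷ (Κ (ι 9) ⊛ₑ (1-3ₑ v₀) ^ₑ 3 ⊛ₑ v₁ ⊕ₑ 1-3ₑ v₀ ⊛ₑ horner (ι 1 ∷ ι 22 ∷ ι 48 ∷ - ι 96 ∷ - ι 285 ∷ - ι 162 ∷ []) v₀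
    , θu-equation-in (θ (θ (θ h))) (θ (θ (θ (θ h)))))
  ∷ (Κ (ι 9) ⊛ₑ v₀ ⊛ₑ 1+ₑ v₀ , weaken-equation (map θ (u ∷ θ (θ (θ h)) ∷ [])) θ³h-equation)
  ∷ []) refl)

θᵏh : Env 6
θᵏh = X ∷ u ∷ θ h ∷ θ (θ h) ∷ θ (θ (θ h)) ∷ θ (θ (θ (θ h))) ∷ []

odeP odeQ : Expr ℚ 6
odeP = Κ (ι 6) ⊛ₑ v₂ ⊕ₑ Κ (ι 33) ⊛ₑ v₃ ⊕ₑ Κ (ι 54) ⊛ₑ v₄ ⊕ₑ Κ (ι 27) ⊛ₑ v₅
odeQ = Κ (ι 120) ⊛ₑ hₑ v₁ ⊕ₑ Κ (ι 616) ⊛ₑ v₂ ⊕ₑ Κ (ι 1136) ⊛ₑ v₃ ⊕ₑ Κ (ι 896) ⊛ₑ v₄ ⊕ₑ Κ (ι 256) ⊛ₑ v₅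

-- The θᵏh-equations express θᵏh as rational functions of u with denominators powers of 1 − 3u,
-- and x as u / (1 + u)⁴; so the equation holds after clearing these denominators.
h-ode : ⟦ odeP ⟧ θᵏh ≗ ⟦ v₀ ⊛ₑ odeQ ⊕ₑ Κ (ι 120) ⊛ₑ v₀ ⟧ θᵏh
h-ode = ⊛-cancelˡ {a = ⟦ denominator ⟧ (u ∷ [])} (λ eq → 1≢0 (trans (sym denominator-at-0) eq))
  (≗-by-certificate θᵏh (denominator′ ⊛ₑ odeP) (denominator′ ⊛ₑ (v₀ ⊛ₑ odeQ ⊕ₑ Κ (ι 120) ⊛ₑ v₀))
    ( (multiplier 6 616 5 , equation v₂ (numerator₁ v₁) (Equation.holds θ¹h-equation))
    ∷ (multiplier 33 1136 4 , equation (1-3ₑ v₁ ⊛ₑ v₃) (numerator₂ v₁) (Equation.holds θ²h-equation))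
    ∷ (multiplier 54 896 2 , equation ((1-3ₑ v₁) ^ₑ 3 ⊛ₑ v₄) (numerator₃ v₁)
                                     (Equation.holds θ³h-equation))
    ∷ (multiplier 27 256 0 , equation ((1-3ₑ v₁) ^ₑ 5 ⊛ₑ v₅)
                                     (numerator₄ v₁)
                                     (Equation.holds θ⁴h-equation))
    ∷ (uMultiplier , equation v₁ (v₀ ⊛ₑ (1+ₑ v₁) ^ₑ 4) (Equation.holds u-equation))
    ∷ []) refl)
  where
  denominator : ∀ {n} → Expr ℚ (1 ℕ.+ n)
  denominator = (1-3ₑ v₀) ^ₑ 5 ⊛ₑ (1+ₑ v₀) ^ₑ 4
  denominator′ : Expr ℚ 6
  denominator′ = (1-3ₑ v₁) ^ₑ 5 ⊛ₑ (1+ₑ v₁) ^ₑ 4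
  denominator-at-0 : ⟦ denominator ⟧ (u ∷ []) 0 ≡ 1ℚ
  denominator-at-0 = trans (⟦⟧-at-0 denominator (u ∷ []) _) (cong (λ c → ℚ-Eval.⟦ denominator ⟧ (c ∷ [])) u-at-0)
  1≢0 : 1ℚ ≢ 0ℚ
  1≢0 ()
  multiplier : ℕ → ℕ → ℕ → Expr ℚ 6
  multiplier a b k = (Κ (ι a) ⊕ₑ ⊖ₑ (Κ (ι b) ⊛ₑ v₀)) ⊛ₑ (1+ₑ v₁) ^ₑ 4 ⊛ₑ (1-3ₑ v₁) ^ₑ k
  uMultiplier : Expr ℚ 6
  uMultiplier = Κ (ι 120) ⊛ₑ (1-3ₑ v₁) ^ₑ 5 ⊛ₑ hₑ v₁
    ⊕ₑ Κ (ι 616) ⊛ₑ (1-3ₑ v₁) ^ₑ 5 ⊛ₑ numerator₁ v₁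
    ⊕ₑ Κ (ι 1136) ⊛ₑ (1-3ₑ v₁) ^ₑ 4 ⊛ₑ numerator₂ v₁
    ⊕ₑ Κ (ι 896) ⊛ₑ (1-3ₑ v₁) ^ₑ 2 ⊛ₑ numerator₃ v₁
    ⊕ₑ Κ (ι 256) ⊛ₑ numerator₄ v₁
    ⊕ₑ Κ (ι 120) ⊛ₑ (1-3ₑ v₁) ^ₑ 5

-- The recurrence

-- The coefficients at xⁿ of the two operators of the differential equation.
p q : ℕ → ℕ
p n = 3 ℕ.* n ℕ.* (n ℕ.+ 1) ℕ.* (3 ℕ.* n ℕ.+ 1) ℕ.* (3 ℕ.* n ℕ.+ 2)
q n = (4 ℕ.* n ℕ.+ 2) ℕ.* (4 ℕ.* n ℕ.+ 3) ℕ.* (4 ℕ.* n ℕ.+ 4) ℕ.* (4 ℕ.* n ℕ.+ 5)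

odeP-at : ∀ n → ⟦ odeP ⟧ θᵏh n ≡ ι (p n) * h n
odeP-at n = begin
  ⟦ odeP ⟧ θᵏh n
    ≡⟨ cong₂ _+_ (cong₂ _+_ (cong₂ _+_ (const-⊛ (ι 6) (θ h) n) (const-⊛ (ι 33) (θ (θ h)) n))
                            (const-⊛ (ι 54) (θ (θ (θ h))) n))
                 (const-⊛ (ι 27) (θ (θ (θ (θ h)))) n) ⟩
  ι 6 * (t * y) + ι 33 * (t * (t * y)) + ι 54 * (t * (t * (t * y))) + ι 27 * (t * (t * (t * (t * y))))
    ≡⟨ factorise t y ⟩
  ι 3 * t * (t + ι 1) * (ι 3 * t + ι 1) * (ι 3 * t + ι 2) * y
    ≡⟨ cong (_* y) ι-p ⟨
  ι (p n) * h n ∎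
  where
  t = ι n
  y = h n
  factorise : ∀ t y →
    ι 6 * (t * y) + ι 33 * (t * (t * y)) + ι 54 * (t * (t * (t * y))) + ι 27 * (t * (t * (t * (t * y))))
      ≡ ι 3 * t * (t + ι 1) * (ι 3 * t + ι 1) * (ι 3 * t + ι 2) * y
  factorise = solve-∀ ℚ-ring
  ι-p : ι (p n) ≡ ι 3 * t * (t + ι 1) * (ι 3 * t + ι 1) * (ι 3 * t + ι 2)
  ι-p = begin
    ι (3 ℕ.* n ℕ.* (n ℕ.+ 1) ℕ.* (3 ℕ.* n ℕ.+ 1) ℕ.* (3 ℕ.* n ℕ.+ 2))
      ≡⟨ ι-* (3 ℕ.* n ℕ.* (n ℕ.+ 1) ℕ.* (3 ℕ.* n ℕ.+ 1)) (3 ℕ.* n ℕ.+ 2) ⟩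
    ι (3 ℕ.* n ℕ.* (n ℕ.+ 1) ℕ.* (3 ℕ.* n ℕ.+ 1)) * ι (3 ℕ.* n ℕ.+ 2)
      ≡⟨ cong₂ _*_ (ι-* (3 ℕ.* n ℕ.* (n ℕ.+ 1)) (3 ℕ.* n ℕ.+ 1)) (ι-affine 3 n 2) ⟩
    ι (3 ℕ.* n ℕ.* (n ℕ.+ 1)) * ι (3 ℕ.* n ℕ.+ 1) * (ι 3 * t + ι 2)
      ≡⟨ cong₂ (λ a b → a * b * (ι 3 * t + ι 2))
           (trans (ι-* (3 ℕ.* n) (n ℕ.+ 1)) (cong₂ _*_ (ι-* 3 n) (ι-+ n 1))) (ι-affine 3 n 1) ⟩
    ι 3 * t * (t + ι 1) * (ι 3 * t + ι 1) * (ι 3 * t + ι 2) ∎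

odeQ-at : ∀ n → ⟦ odeQ ⟧ θᵏh n ≡ ι (q n) * h n
odeQ-at n = begin
  ⟦ odeQ ⟧ θᵏh n
    ≡⟨ cong₂ _+_ (cong₂ _+_ (cong₂ _+_ (cong₂ _+_ (const-⊛ (ι 120) h n) (const-⊛ (ι 616) (θ h) n))
                                      (const-⊛ (ι 1136) (θ (θ h)) n))
                            (const-⊛ (ι 896) (θ (θ (θ h))) n))
                 (const-⊛ (ι 256) (θ (θ (θ (θ h)))) n) ⟩
  ι 120 * y + ι 616 * (s * y) + ι 1136 * (s * (s * y)) + ι 896 * (s * (s * (s * y)))
    + ι 256 * (s * (s * (s * (s * y))))
    ≡⟨ factorise s y ⟩
  (ι 4 * s + ι 2) * (ι 4 * s + ι 3) * (ι 4 * s + ι 4) * (ι 4 * s + ι 5) * y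
    ≡⟨ cong (_* y) ι-q ⟨
  ι (q n) * h n ∎
  where
  s = ι n
  y = h n
  factorise : ∀ s y →
    ι 120 * y + ι 616 * (s * y) + ι 1136 * (s * (s * y)) + ι 896 * (s * (s * (s * y)))
      + ι 256 * (s * (s * (s * (s * y))))
      ≡ (ι 4 * s + ι 2) * (ι 4 * s + ι 3) * (ι 4 * s + ι 4) * (ι 4 * s + ι 5) * y
  factorise = solve-∀ ℚ-ring
  ι-q : ι (q n) ≡ (ι 4 * s + ι 2) * (ι 4 * s + ι 3) * (ι 4 * s + ι 4) * (ι 4 * s + ι 5)
  ι-q = begin
    ι ((4 ℕ.* n ℕ.+ 2) ℕ.* (4 ℕ.* n ℕ.+ 3) ℕ.* (4 ℕ.* n ℕ.+ 4) ℕ.* (4 ℕ.* n ℕ.+ 5))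
      ≡⟨ ι-* ((4 ℕ.* n ℕ.+ 2) ℕ.* (4 ℕ.* n ℕ.+ 3) ℕ.* (4 ℕ.* n ℕ.+ 4)) (4 ℕ.* n ℕ.+ 5) ⟩
    ι ((4 ℕ.* n ℕ.+ 2) ℕ.* (4 ℕ.* n ℕ.+ 3) ℕ.* (4 ℕ.* n ℕ.+ 4)) * ι (4 ℕ.* n ℕ.+ 5)
      ≡⟨ cong₂ _*_ (ι-* ((4 ℕ.* n ℕ.+ 2) ℕ.* (4 ℕ.* n ℕ.+ 3)) (4 ℕ.* n ℕ.+ 4)) (ι-affine 4 n 5) ⟩
    ι ((4 ℕ.* n ℕ.+ 2) ℕ.* (4 ℕ.* n ℕ.+ 3)) * ι (4 ℕ.* n ℕ.+ 4) * (ι 4 * s + ι 5)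
      ≡⟨ cong₂ (λ a b → a * b * (ι 4 * s + ι 5))
           (trans (ι-* (4 ℕ.* n ℕ.+ 2) (4 ℕ.* n ℕ.+ 3)) (cong₂ _*_ (ι-affine 4 n 2) (ι-affine 4 n 3)))
           (ι-affine 4 n 4) ⟩
    (ι 4 * s + ι 2) * (ι 4 * s + ι 3) * (ι 4 * s + ι 4) * (ι 4 * s + ι 5) ∎

h-recurrence : ∀ m → ι (p (suc m)) * h (suc m) ≡ ι (q m) * h m + ι 120 * X (suc m)
h-recurrence m = begin
  ι (p (suc m)) * h (suc m)                                  ≡⟨ odeP-at (suc m) ⟨
  ⟦ odeP ⟧ θᵏh (suc m)                                       ≡⟨ h-ode (suc m) ⟩
  (X ⊛ ⟦ odeQ ⟧ θᵏh) (suc m) + (const (ι 120) ⊛ X) (suc m)   ≡⟨ cong₂ _+_ (X⊛-at-suc (⟦ odeQ ⟧ θᵏh) m)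
                                                                           (const-⊛ (ι 120) X (suc m)) ⟩
  ⟦ odeQ ⟧ θᵏh m + ι 120 * X (suc m)                         ≡⟨ cong (_+ ι 120 * X (suc m)) (odeQ-at m) ⟩
  ι (q m) * h m + ι 120 * X (suc m)                          ∎

recurrence-unique : ∀ (a b c : ℕ → ℚ) {f f′ : ℕ → ℚ} → (∀ m → a m ≢ 0ℚ) →
  (∀ m → a m * f (suc m) ≡ b m * f m + c m) → (∀ m → a m * f′ (suc m) ≡ b m * f′ m + c m) →
  f 0 ≡ f′ 0 → f ≗ f′
recurrence-unique a b c a≢0 rec rec′ f₀≡f′₀ zero    = f₀≡f′₀
recurrence-unique a b c {f} {f′} a≢0 rec rec′ f₀≡f′₀ (suc m) = *-cancelˡ-≡ (a m) (a≢0 m) (begin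
  a m * f (suc m)      ≡⟨ rec m ⟩
  b m * f m + c m      ≡⟨ cong (λ y → b m * y + c m) (recurrence-unique a b c a≢0 rec rec′ f₀≡f′₀ m) ⟩
  b m * f′ m + c m     ≡⟨ rec′ m ⟨
  a m * f′ (suc m)     ∎)

gNumerator gDenominator : ℕ → ℕ
gNumerator   n = 2 ℕ.* (4 ℕ.* n ℕ.+ 1) !
gDenominator n = (n ℕ.+ 1) ! ℕ.* (3 ℕ.* n ℕ.+ 2) !

gDenominator-nonZero : ∀ n → ℕ.NonZero (gDenominator n)
gDenominator-nonZero n = (n ℕ.+ 1) ℕ.!* (3 ℕ.* n ℕ.+ 2) !≢0

factorial-ratio : ∀ n → p (suc n) ℕ.* gNumerator (suc n) ℕ.* gDenominator n
                      ≡ q n ℕ.* gNumerator n ℕ.* gDenominator (suc n)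
factorial-ratio n = begin
  p (suc n) ℕ.* (2 ℕ.* (4 ℕ.* suc n ℕ.+ 1) !) ℕ.* gDenominator n
    ≡⟨ cong (λ k → p (suc n) ℕ.* (2 ℕ.* k !) ℕ.* gDenominator n) (shift 4 n 1) ⟩
  p (suc n) ℕ.* (2 ℕ.* (4 ℕ.+ (4 ℕ.* n ℕ.+ 1)) !) ℕ.* gDenominator n
    ≡⟨ unfolded n ((4 ℕ.* n ℕ.+ 1) !) ((n ℕ.+ 1) !) ((3 ℕ.* n ℕ.+ 2) !) ⟩
  q n ℕ.* gNumerator n ℕ.* ((suc n ℕ.+ 1) ! ℕ.* (3 ℕ.+ (3 ℕ.* n ℕ.+ 2)) !)
    ≡⟨ cong (λ k → q n ℕ.* gNumerator n ℕ.* ((suc n ℕ.+ 1) ! ℕ.* k !)) (shift 3 n 2) ⟨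
  q n ℕ.* gNumerator n ℕ.* gDenominator (suc n) ∎
  where
  shift : ∀ a n b → a ℕ.* suc n ℕ.+ b ≡ a ℕ.+ (a ℕ.* n ℕ.+ b)
  shift a n b = trans (cong (ℕ._+ b) (ℕ.*-suc a n)) (ℕ.+-assoc a (a ℕ.* n) b)
  unfolded : ∀ n A B C →
      3 ℕ.* suc n ℕ.* (suc n ℕ.+ 1) ℕ.* (3 ℕ.* suc n ℕ.+ 1) ℕ.* (3 ℕ.* suc n ℕ.+ 2)
        ℕ.* (2 ℕ.* ((4 ℕ.+ (4 ℕ.* n ℕ.+ 1)) ℕ.* ((3 ℕ.+ (4 ℕ.* n ℕ.+ 1)) ℕ.*
               ((2 ℕ.+ (4 ℕ.* n ℕ.+ 1)) ℕ.* ((1 ℕ.+ (4 ℕ.* n ℕ.+ 1)) ℕ.* A)))))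
        ℕ.* (B ℕ.* C)
    ≡ (4 ℕ.* n ℕ.+ 2) ℕ.* (4 ℕ.* n ℕ.+ 3) ℕ.* (4 ℕ.* n ℕ.+ 4) ℕ.* (4 ℕ.* n ℕ.+ 5)
        ℕ.* (2 ℕ.* A)
        ℕ.* (((1 ℕ.+ (n ℕ.+ 1)) ℕ.* B) ℕ.* ((3 ℕ.+ (3 ℕ.* n ℕ.+ 2)) ℕ.*
               ((2 ℕ.+ (3 ℕ.* n ℕ.+ 2)) ℕ.* ((1 ℕ.+ (3 ℕ.* n ℕ.+ 2)) ℕ.* C))))
  unfolded = ℕ-Solver.solve-∀

g-recurrence : ∀ m → ι (p (suc m)) * g (suc m) ≡ ι (q m) * g m + ι 120 * X (suc m)
g-recurrence zero    = refl
g-recurrence (suc n) = begin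
  ι (p (suc (suc n))) * g (suc (suc n))              ≡⟨ ratio ⟩
  ι (q (suc n)) * g (suc n)                          ≡⟨ ℚ.+-identityʳ _ ⟨
  ι (q (suc n)) * g (suc n) + 0ℚ                     ≡⟨ cong (ι (q (suc n)) * g (suc n) +_) (ℚ.*-zeroʳ (ι 120)) ⟨
  ι (q (suc n)) * g (suc n) + ι 120 * X (suc (suc n)) ∎
  where
  instance
    _ = gDenominator-nonZero (suc n)
    _ = gDenominator-nonZero (suc (suc n))
  ratio : ι (p (suc (suc n))) * (ℤ.+ gNumerator (suc (suc n)) / gDenominator (suc (suc n)))
        ≡ ι (q (suc n)) * (ℤ.+ gNumerator (suc n) / gDenominator (suc n))
  ratio = ι-*-/-cross (p (suc (suc n))) (q (suc n))
    {gNumerator (suc n)} {gNumerator (suc (suc n))} {gDenominator (suc n)} {gDenominator (suc (suc n))}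
    (factorial-ratio (suc n))

h≗g : h ≗ g
h≗g = recurrence-unique (ι ∘ p ∘ suc) (ι ∘ q) (λ m → ι 120 * X (suc m)) (λ m → ι-nonZero (p (suc m)))
  h-recurrence g-recurrence h-at-0

mainTheorem3 : ∀ (n : ℕ) → lhs g n ≡ 0ℚ
mainTheorem3 n = begin
  lhs g n  ≡⟨ ⟦⟧-cong (lhsₑ v₀ v₁) {X ∷ h ∷ []} {X ∷ g ∷ []} (λ { 0F _ → refl ; 1F → h≗g }) n ⟨
  lhs h n  ≡⟨ lhs-h n ⟩
  0ℚ       ∎
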